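{- Let $G$ be a finite graph with $n = |V(G)| \geq 1$ vertices. Then there is a graph $G'$ containing $G$ as an induced subgraph such that $G'$ is simple and $|V(G')| - |V(G)| \leq \lceil \log_2(n+1) \rceil$.
   Context: Graphs are finite, undirected, without loops or multiple edges. An interval of a graph $H$ is a set $I \subseteq V(H)$ such that $N(u)\setminus I = N(v)\setminus I$ for all $u,v \in I$, where $N(u)$ is the neighbourhood of $u$. The empty set, all singletons and $V(H)$ are intervals; any other interval is proper. A graph is simple if it has no proper intervals. -}

module Defs where

open import Data.Nat using (ℕ)
open import Data.Fin using (Fin)
open import Data.Bool using (Bool; true; false)
open import Data.Product using (Σ; ∃; _×_)
open import Data.Sum using (_⊎_)
open import Relation.Binary.PropositionalEquality using (_≡_)
open import Function.Definitions using (Injective)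

record Graph (n : ℕ) : Set where
  field
    adj    : Fin n → Fin n → Bool
    sym    : ∀ u v → adj u v ≡ adj v u
    irrefl : ∀ u → adj u u ≡ false
open Graph public

VSet : ℕ → Set
VSet n = Fin n → Bool

IsInterval : ∀ {n} → Graph n → VSet n → Set
IsInterval {n} G I =
  ∀ (u v w : Fin n) → I u ≡ true → I v ≡ true → I w ≡ false →
  adj G u w ≡ adj G v w

IsTrivial : ∀ {n} → VSet n → Set
IsTrivial {n} I =
  (∀ x → I x ≡ false)
  ⊎ (Σ (Fin n) λ x → ∀ y → (I y ≡ true → y ≡ x) × (y ≡ x → I y ≡ true))
  ⊎ (∀ x → I x ≡ true)

IsSimple : ∀ {n} → Graph n → Set
IsSimple {n} G = ∀ (I : VSet n) → IsInterval G I → IsTrivial I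

InducedSubgraph : ∀ {n m} → Graph n → Graph m → Set
InducedSubgraph {n} {m} G H =
  Σ (Fin n → Fin m) λ f → Injective _≡_ _≡_ f ×
    (∀ u v → adj H (f u) (f v) ≡ adj G u v)

-- Choose j with 2^j ≤ n < 2^(j+1), number the vertices of G injectively by 0 … n − 1 and add
-- j + 1 pairwise non-adjacent new vertices, joining each old vertex to the new vertices indexed by
-- the zero bits of its number.  An interval with two elements is then forced to contain a new
-- vertex and an old one, next every new vertex, and finally every old one.  This works as soon as
-- the codes are injective and nonempty, every co-singleton {i}ᶜ with i < j is a code, and the
-- singleton codes, which only occur for numbers ≥ 2^j − 1, belong to non-neighbours of the hub
-- numbered 0.  So the hub needs fewer than 2^j − 1 neighbours, in G or in its complement (whose
-- extension, complemented back, serves as well); if no vertex qualifies, G is (2^j − 1)-regular on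
-- 2^(j+1) − 1 vertices, impossible by the handshake lemma since both numbers are odd.

module Submission where

open import Data.Nat renaming (_≟_ to _≟ℕ_)
open import Data.Nat.Properties hiding (_≟_; suc-injective)
open import Algebra.Properties.CommutativeMonoid.Sum +-0-commutativeMonoid
  using (sum-syntax; ∑-distrib-+; sum-remove; sum-cong-≗)
open import Data.Bool using (Bool; true; false; not; _∧_; if_then_else_)
open import Data.Bool.Properties
  using (not-injective; not-involutive; ∧-zeroʳ; ∧-identityʳ; ¬-not) renaming (_≟_ to _≟ᵇ_)
open import Data.Empty using (⊥; ⊥-elim)
open import Data.Fin
  using (Fin; zero; suc; toℕ; fromℕ; fromℕ<; inject₁; punchIn; punchOut; splitAt; join; _↑ˡ_; _≟_)
open import Data.Fin.Properties
  using (any?; all?; ¬∀⟶∃¬; suc-injective; toℕ-injective; toℕ-fromℕ<; toℕ-fromℕ; toℕ<n; toℕ-inject₁;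
         fromℕ≢inject₁; inject₁-injective; punchOut-injective; punchIn-punchOut; punchInᵢ≢i; injective⇒≤;
         splitAt-join; join-splitAt; splitAt-↑ˡ; ↑ˡ-injective)
open import Data.Nat.Divisibility using (_∣_; _∣0; ∣m∣n⇒∣m+n; ∣m+n∣m⇒∣n; m∣m*n; ∣1⇒≡1)
open import Data.Nat.Logarithm
  using (⌈log₂_⌉; ⌈log₂⌉-mono-≤; ⌈log₂⌈n/2⌉⌉≡⌈log₂n⌉∸1; ⌈log₂2^n⌉≡n)
open import Data.Nat.Primality using (euclidsLemma; prime[2])
open import Data.Product using (Σ; _,_; _×_; ∃; proj₁; proj₂)
open import Data.Sum using (_⊎_; inj₁; inj₂; [_,_]′)
open import Function using (_∘_)
open import Function.Definitions using (Injective)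
open import Relation.Binary.PropositionalEquality
  using (_≡_; _≢_; refl; sym; trans; cong; cong₂; subst; module ≡-Reasoning)
open import Relation.Nullary using (¬_; yes; no; does; ¬?; _×-dec_; contradiction)
open import Relation.Nullary.Decidable using (dec-true; dec-false)
open import Defs hiding (sym)

indicator : Bool → ℕ
indicator b = if b then 1 else 0

lowBit : ℕ → Bool
lowBit zero          = false
lowBit (suc zero)    = true
lowBit (suc (suc m)) = lowBit m

testBit : ℕ → ℕ → Bool
testBit m zero    = lowBit m
testBit m (suc i) = testBit ⌊ m /2⌋ i

lowBit+2*⌊m/2⌋≡m : ∀ m → indicator (lowBit m) + 2 * ⌊ m /2⌋ ≡ m
lowBit+2*⌊m/2⌋≡m zero          = refl
lowBit+2*⌊m/2⌋≡m (suc zero)    = refl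
lowBit+2*⌊m/2⌋≡m (suc (suc m)) = begin
  b + 2 * suc h        ≡⟨ cong (b +_) (*-suc 2 h) ⟩
  b + (2 + 2 * h)      ≡⟨ +-suc b _ ⟩
  suc (b + (1 + 2 * h)) ≡⟨ cong suc (+-suc b _) ⟩
  2 + (b + 2 * h)      ≡⟨ cong (2 +_) (lowBit+2*⌊m/2⌋≡m m) ⟩
  2 + m                ∎
  where
  open ≡-Reasoning
  b = indicator (lowBit m)
  h = ⌊ m /2⌋

2*⌊m/2⌋≤m : ∀ m → 2 * ⌊ m /2⌋ ≤ m
2*⌊m/2⌋≤m m = ≤-trans (m≤n+m _ (indicator (lowBit m))) (≤-reflexive (lowBit+2*⌊m/2⌋≡m m))

lowBit-2* : ∀ h → lowBit (2 * h) ≡ false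
lowBit-2* zero = refl
lowBit-2* (suc h) rewrite *-suc 2 h = lowBit-2* h

⌊2*h/2⌋≡h : ∀ h → ⌊ 2 * h /2⌋ ≡ h
⌊2*h/2⌋≡h zero = refl
⌊2*h/2⌋≡h (suc h) rewrite *-suc 2 h = cong suc (⌊2*h/2⌋≡h h)

testBit-0 : ∀ i → testBit 0 i ≡ false
testBit-0 zero    = refl
testBit-0 (suc i) = testBit-0 i

testBit-2^ : ∀ i j → testBit (2 ^ i) j ≡ does (i ≟ℕ j)
testBit-2^ zero    zero    = refl
testBit-2^ zero    (suc j) = testBit-0 j
testBit-2^ (suc i) zero    = lowBit-2* (2 ^ i)
testBit-2^ (suc i) (suc j) rewrite ⌊2*h/2⌋≡h (2 ^ i) = testBit-2^ i j

testBit⇒2^≤ : ∀ i m → testBit m i ≡ true → 2 ^ i ≤ m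
testBit⇒2^≤ zero    (suc m) _ = s≤s z≤n
testBit⇒2^≤ (suc i) m bit = ≤-trans (*-monoʳ-≤ 2 (testBit⇒2^≤ i ⌊ m /2⌋ bit)) (2*⌊m/2⌋≤m m)

lowBits-set⇒2^≤suc : ∀ k m → (∀ i → i < k → testBit m i ≡ true) → 2 ^ k ≤ suc m
lowBits-set⇒2^≤suc zero    m _    = s≤s z≤n
lowBits-set⇒2^≤suc (suc k) m bits = begin
  2 * 2 ^ k       ≤⟨ *-monoʳ-≤ 2 (lowBits-set⇒2^≤suc k ⌊ m /2⌋ (λ i i<k → bits (suc i) (s≤s i<k))) ⟩
  2 * suc ⌊ m /2⌋ ≡⟨ *-suc 2 ⌊ m /2⌋ ⟩
  2 + 2 * ⌊ m /2⌋ ≡⟨ cong (λ b → suc (indicator b + 2 * ⌊ m /2⌋)) (sym (bits 0 z<s)) ⟩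
  suc (indicator (lowBit m) + 2 * ⌊ m /2⌋) ≡⟨ cong suc (lowBit+2*⌊m/2⌋≡m m) ⟩
  suc m           ∎
  where open ≤-Reasoning

⌊m/2⌋<n : ∀ {m} n → m < 2 * n → ⌊ m /2⌋ < n
⌊m/2⌋<n {m} n m<2n = *-cancelˡ-< 2 _ _ (≤-<-trans (2*⌊m/2⌋≤m m) m<2n)

testBit-injective : ∀ k {m m′} → m < 2 ^ k → m′ < 2 ^ k →
                    (∀ i → i < k → testBit m i ≡ testBit m′ i) → m ≡ m′
testBit-injective zero    {zero}  {zero}   _         _          _ = refl
testBit-injective zero    {suc _} {_}      (s≤s ()) _          _
testBit-injective zero    {_}     {suc _}  _         (s≤s ())   _
testBit-injective (suc k) {m} {m′} m< m′< same = begin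
  m                                      ≡⟨ sym (lowBit+2*⌊m/2⌋≡m m) ⟩
  indicator (lowBit m) + 2 * ⌊ m /2⌋ ≡⟨ cong₂ (λ b h → indicator b + 2 * h) (same 0 z<s) halves ⟩
  indicator (lowBit m′) + 2 * ⌊ m′ /2⌋ ≡⟨ lowBit+2*⌊m/2⌋≡m m′ ⟩
  m′                                     ∎
  where
  open ≡-Reasoning
  halves : ⌊ m /2⌋ ≡ ⌊ m′ /2⌋
  halves = testBit-injective k (⌊m/2⌋<n (2 ^ k) m<) (⌊m/2⌋<n (2 ^ k) m′<) (λ i i<k → same (suc i) (s≤s i<k))

complement : ∀ {n} → Graph n → Graph n
complement G = record
  { adj    = λ u v → not (adj G u v) ∧ not (does (u ≟ v))
  ; sym    = λ u v → cong₂ (λ a b → not a ∧ not b) (Graph.sym G u v) (≟-sym u v)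
  ; irrefl = λ u → trans (cong (λ b → not (adj G u u) ∧ not b) (dec-true (u ≟ u) refl)) (∧-zeroʳ _)
  }
  where
  ≟-sym : ∀ {n} (u v : Fin n) → does (u ≟ v) ≡ does (v ≟ u)
  ≟-sym u v with u ≟ v
  ... | yes refl = sym (dec-true (u ≟ u) refl)
  ... | no u≢v   = sym (dec-false (v ≟ u) (u≢v ∘ sym))

adj-complement : ∀ {n} (G : Graph n) {u v} → u ≢ v → adj (complement G) u v ≡ not (adj G u v)
adj-complement G {u} {v} u≢v =
  trans (cong (λ b → not (adj G u v) ∧ not b) (dec-false (u ≟ v) u≢v)) (∧-identityʳ _)

complement-isSimple : ∀ {n} (G : Graph n) → IsSimple G → IsSimple (complement G)
complement-isSimple G simple I interval = simple I λ u v w Iu Iv Iw →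
  not-injective (begin
    not (adj G u w)          ≡⟨ sym (adj-complement G (outside Iu Iw)) ⟩
    adj (complement G) u w   ≡⟨ interval u v w Iu Iv Iw ⟩
    adj (complement G) v w   ≡⟨ adj-complement G (outside Iv Iw) ⟩
    not (adj G v w)          ∎)
  where
  open ≡-Reasoning
  outside : ∀ {x w} → I x ≡ true → I w ≡ false → x ≢ w
  outside Ix Iw refl with () ← trans (sym Ix) Iw

induced-in-complement : ∀ {n m} (G : Graph n) (H : Graph m) →
                        InducedSubgraph (complement G) H → InducedSubgraph G (complement H)
induced-in-complement G H (f , f-inj , f-adj) = f , f-inj , preserves
  where
  preserves : ∀ u v → adj (complement H) (f u) (f v) ≡ adj G u v
  preserves u v with u ≟ v
  ... | yes refl = trans (Graph.irrefl (complement H) (f u)) (sym (Graph.irrefl G u))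
  ... | no u≢v   = begin
    adj (complement H) (f u) (f v) ≡⟨ adj-complement H (u≢v ∘ f-inj) ⟩
    not (adj H (f u) (f v))         ≡⟨ cong not (f-adj u v) ⟩
    not (adj (complement G) u v)    ≡⟨ cong not (adj-complement G u≢v) ⟩
    not (not (adj G u v))           ≡⟨ not-involutive _ ⟩
    adj G u v                       ∎
    where open ≡-Reasoning

isTrivial-if-pair-full : ∀ {n} (I : VSet n) →
  (∀ a b → a ≢ b → I a ≡ true → I b ≡ true → ∀ c → I c ≡ true) → IsTrivial I
isTrivial-if-pair-full I pair-full with any? (λ x → I x ≟ᵇ true)
... | no empty = inj₁ (λ x → ¬-not (empty ∘ (x ,_)))
... | yes (a , Ia) with any? (λ b → ¬? (b ≟ a) ×-dec (I b ≟ᵇ true))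
...   | yes (b , b≢a , Ib) = inj₂ (inj₂ (pair-full a b (b≢a ∘ sym) Ia Ib))
...   | no  alone          = inj₂ (inj₁ (a , λ y → only y , λ { refl → Ia }))
  where
  only : ∀ y → I y ≡ true → y ≡ a
  only y Iy with y ≟ a
  ... | yes y≡a = y≡a
  ... | no  y≢a = contradiction (y , y≢a , Iy) alone

true≢false : true ≢ false
true≢false ()

module _ {n k} (K : Graph n) (code : Fin n → Fin k → Bool) where

  codeAdj : Fin n ⊎ Fin k → Fin n ⊎ Fin k → Bool
  codeAdj (inj₁ p) (inj₁ q) = adj K p q
  codeAdj (inj₁ p) (inj₂ i) = code p i
  codeAdj (inj₂ i) (inj₁ p) = code p i
  codeAdj (inj₂ _) (inj₂ _) = false

  codeAdj-sym : ∀ u v → codeAdj u v ≡ codeAdj v u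
  codeAdj-sym (inj₁ p) (inj₁ q) = Graph.sym K p q
  codeAdj-sym (inj₁ _) (inj₂ _) = refl
  codeAdj-sym (inj₂ _) (inj₁ _) = refl
  codeAdj-sym (inj₂ _) (inj₂ _) = refl

  codeAdj-irrefl : ∀ u → codeAdj u u ≡ false
  codeAdj-irrefl (inj₁ p) = Graph.irrefl K p
  codeAdj-irrefl (inj₂ _) = refl

  extendByCode : Graph (n + k)
  extendByCode = record
    { adj    = λ u v → codeAdj (splitAt n u) (splitAt n v)
    ; sym    = λ u v → codeAdj-sym (splitAt n u) (splitAt n v)
    ; irrefl = λ u → codeAdj-irrefl (splitAt n u)
    }

  MissesOnly : Fin n → Fin k → Set
  MissesOnly w c = code w c ≡ false × (∀ i → i ≢ c → code w i ≡ true)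

  record IsSimpleCode : Set where
    field
      hub              : Fin n
      hub-full         : ∀ i → code hub i ≡ true
      injective        : ∀ p q → (∀ i → code p i ≡ code q i) → p ≡ q
      nonempty         : ∀ p → ∃ λ i → code p i ≡ true
      missesOnly       : ∀ a b → a ≢ b → (∃ λ w → MissesOnly w a) ⊎ (∃ λ w → MissesOnly w b)
      singleton-¬hub   : ∀ p s → (∀ i → code p i ≡ true → i ≡ s) → adj K p hub ≡ false
      hub-nonneighbour : ∃ λ q → q ≢ hub × adj K q hub ≡ false

  module Intervals (simpleCode : IsSimpleCode) (J : Fin n ⊎ Fin k → Bool)
    (interval : ∀ u v w → J u ≡ true → J v ≡ true → J w ≡ false → codeAdj u w ≡ codeAdj v w)
    where
    open IsSimpleCode simpleCode

    forced : ∀ {u v} w → J u ≡ true → J v ≡ true → codeAdj u w ≢ codeAdj v w → J w ≡ true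
    forced {u} {v} w Ju Jv differ with J w in Jw
    ... | true  = refl
    ... | false = contradiction (interval u v w Ju Jv Jw) differ

    separatingLabel : ∀ {p q} → p ≢ q → ∃ λ i → code p i ≢ code q i
    separatingLabel {p} {q} p≢q with all? (λ i → code p i ≟ᵇ code q i)
    ... | yes same = contradiction (injective p q same) p≢q
    ... | no  ¬same = ¬∀⟶∃¬ k _ (λ i → code p i ≟ᵇ code q i) ¬same

    separatingVertex : ∀ {a b} → a ≢ b → ∃ λ w → code w a ≢ code w b
    separatingVertex {a} {b} a≢b with missesOnly a b a≢b
    ... | inj₁ (w , wa , others) = w , λ e → true≢false (trans (sym (others b (a≢b ∘ sym))) (trans (sym e) wa))
    ... | inj₂ (w , wb , others) = w , λ e → true≢false (trans (sym (others a a≢b)) (trans e wb))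

    someLabel : ∀ {s t} → s ≢ t → J s ≡ true → J t ≡ true → ∃ λ i → J (inj₂ i) ≡ true
    someLabel {inj₂ i} _ Js _ = i , Js
    someLabel {inj₁ _} {inj₂ i} _ _ Jt = i , Jt
    someLabel {inj₁ _} {inj₁ _} s≢t Js Jt =
      let i , differ = separatingLabel (s≢t ∘ cong inj₁) in i , forced (inj₂ i) Js Jt differ

    someVertex : ∀ {s t} → s ≢ t → J s ≡ true → J t ≡ true → ∃ λ p → J (inj₁ p) ≡ true
    someVertex {inj₁ p} _ Js _ = p , Js
    someVertex {inj₂ _} {inj₁ p} _ _ Jt = p , Jt
    someVertex {inj₂ _} {inj₂ _} s≢t Js Jt =
      let p , differ = separatingVertex (s≢t ∘ cong inj₂) in p , forced (inj₁ p) Js Jt differ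

    -- With the new vertex l outside J, no old vertex of J has l in its code, while every label of p
    -- lies in J.
    allLabels : ∀ {i p} → J (inj₂ i) ≡ true → J (inj₁ p) ≡ true → ∀ l → J (inj₂ l) ≡ true
    allLabels {i} {p} Ji Jp l with J (inj₂ l) in Jl
    ... | true  = refl
    ... | false = ⊥-elim l∉J-absurd
      where
      misses-l : ∀ {u} → J (inj₁ u) ≡ true → code u l ≡ false
      misses-l Ju = sym (interval (inj₂ i) (inj₁ _) (inj₂ l) Ji Ju Jl)
      labels-in : ∀ {s} → code p s ≡ true → J (inj₂ s) ≡ true
      labels-in {s} ps = forced (inj₂ s) Ji Jp (λ e → true≢false (trans (sym ps) (sym e)))
      a = proj₁ (nonempty p)
      pa = proj₂ (nonempty p)
      misses-only : ∀ {w c c′} → MissesOnly w c → c′ ≢ c → code p c ≡ true → code p c′ ≡ true → ⊥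
      misses-only {w} {c} {c′} (wc , others) c′≢c pc pc′ with J (inj₁ w) in Jw
      ... | true  = true≢false (trans (sym (others l l≢c)) (misses-l Jw))
        where
        l≢c : l ≢ c
        l≢c refl = true≢false (trans (sym pc) (misses-l Jp))
      ... | false = true≢false (trans (sym (others c′ c′≢c))
                      (trans (sym (interval (inj₂ c) (inj₂ c′) (inj₁ w) (labels-in pc) (labels-in pc′) Jw)) wc))
      l∉J-absurd : ⊥
      l∉J-absurd with any? (λ b → ¬? (b ≟ a) ×-dec (code p b ≟ᵇ true))
      ... | yes (b , b≢a , pb) with missesOnly a b (b≢a ∘ sym)
      ...   | inj₁ (_ , misses-a) = misses-only misses-a b≢a pa pb
      ...   | inj₂ (_ , misses-b) = misses-only misses-b (b≢a ∘ sym) pb pa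
      l∉J-absurd | no other with J (inj₁ hub) in Jhub
      ... | true  = true≢false (trans (sym (hub-full l)) (misses-l Jhub))
      ... | false = true≢false (trans (sym (hub-full a))
                      (trans (interval (inj₂ a) (inj₁ p) (inj₁ hub) (labels-in pa) Jp Jhub) p-¬hub))
        where
        only-a : ∀ i → code p i ≡ true → i ≡ a
        only-a i pi with i ≟ a
        ... | yes i≡a = i≡a
        ... | no  i≢a = contradiction (i , i≢a , pi) other
        p-¬hub : adj K p hub ≡ false
        p-¬hub = singleton-¬hub p a only-a

    outside⇒hub : (∀ l → J (inj₂ l) ≡ true) → ∀ {u} → J (inj₁ u) ≡ false → u ≡ hub
    outside⇒hub labels {u} Ju = injective u hub λ i →
      let b , ub = nonempty u in
      trans (interval (inj₂ i) (inj₂ b) (inj₁ u) (labels i) (labels b) Ju) (trans ub (sym (hub-full i)))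

    allVertices : (∀ l → J (inj₂ l) ≡ true) → ∀ q → J (inj₁ q) ≡ true
    allVertices labels q with J (inj₁ q) in Jq
    ... | true  = refl
    ... | false with q′ , q′≢hub , q′-¬hub ← hub-nonneighbour | J (inj₁ q′) in Jq′
    ...   | true  = ⊥-elim (true≢false (trans (sym (hub-full a))
                      (trans (interval (inj₂ a) (inj₁ q′) (inj₁ hub) (labels a) Jq′ Jhub) q′-¬hub)))
      where
      a = proj₁ (nonempty hub)
      Jhub : J (inj₁ hub) ≡ false
      Jhub = subst (λ u → J (inj₁ u) ≡ false) (outside⇒hub labels Jq) Jq
    ...   | false = ⊥-elim (q′≢hub (outside⇒hub labels Jq′))

    pair-full : ∀ s t → s ≢ t → J s ≡ true → J t ≡ true → ∀ r → J r ≡ true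
    pair-full s t s≢t Js Jt = full
      where
      labels : ∀ l → J (inj₂ l) ≡ true
      labels = allLabels (proj₂ (someLabel s≢t Js Jt)) (proj₂ (someVertex s≢t Js Jt))
      full : ∀ r → J r ≡ true
      full (inj₁ q) = allVertices labels q
      full (inj₂ l) = labels l

  extendByCode-isSimple : IsSimpleCode → IsSimple extendByCode
  extendByCode-isSimple simpleCode I interval = isTrivial-if-pair-full I λ a b a≢b Ia Ib c →
    subst (λ x → I x ≡ true) (join-splitAt n k c)
      (pair-full (splitAt n a) (splitAt n b) (a≢b ∘ splitAt-injective) (I-join Ia) (I-join Ib) (splitAt n c))
    where
    J : Fin n ⊎ Fin k → Bool
    J = I ∘ join n k
    I-join : ∀ {x} → I x ≡ true → J (splitAt n x) ≡ true
    I-join {x} Ix = trans (cong I (join-splitAt n k x)) Ix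
    splitAt-injective : ∀ {x y} → splitAt n x ≡ splitAt n y → x ≡ y
    splitAt-injective {x} {y} e = trans (sym (join-splitAt n k x)) (trans (cong (join n k) e) (join-splitAt n k y))
    J-interval : ∀ u v w → J u ≡ true → J v ≡ true → J w ≡ false → codeAdj u w ≡ codeAdj v w
    J-interval u v w Ju Jv Jw = begin
      codeAdj u w
        ≡⟨ cong₂ codeAdj (sym (splitAt-join n k u)) (sym (splitAt-join n k w)) ⟩
      codeAdj (splitAt n (join n k u)) (splitAt n (join n k w))
        ≡⟨ interval _ _ _ Ju Jv Jw ⟩
      codeAdj (splitAt n (join n k v)) (splitAt n (join n k w))
        ≡⟨ cong₂ codeAdj (splitAt-join n k v) (splitAt-join n k w) ⟩
      codeAdj v w ∎
      where open ≡-Reasoning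
    open Intervals simpleCode J J-interval using (pair-full)

  extendByCode-induced : InducedSubgraph K extendByCode
  extendByCode-induced = (_↑ˡ k) , ↑ˡ-injective k _ _ , λ u v →
    cong₂ codeAdj (splitAt-↑ˡ n u k) (splitAt-↑ˡ n v k)

count : ∀ {n} → (Fin n → Bool) → ℕ
count {n} P = ∑[ i < n ] indicator (P i)

degree : ∀ {n} → Graph n → Fin n → ℕ
degree G v = count (adj G v)

∑-const : ∀ n c → ∑[ i < n ] c ≡ n * c
∑-const zero    c = refl
∑-const (suc n) c = cong (c +_) (∑-const n c)

handshake : ∀ {n} (a : Fin n → Fin n → Bool) → (∀ u v → a u v ≡ a v u) → (∀ u → a u u ≡ false) →
            2 ∣ ∑[ u < n ] count (a u)
handshake {zero}  a _ _ = 2 ∣0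
handshake {suc n} a a-sym a-irrefl = subst (2 ∣_) (sym total) (∣m∣n⇒∣m+n (m∣m*n R) rest)
  where
  R = count (a zero ∘ suc)
  S = ∑[ u < n ] count (a (suc u) ∘ suc)
  rest : 2 ∣ S
  rest = handshake (λ u v → a (suc u) (suc v)) (λ u v → a-sym (suc u) (suc v)) (a-irrefl ∘ suc)
  column : ∑[ u < n ] indicator (a (suc u) zero) ≡ R
  column = sum-cong-≗ (λ u → cong indicator (a-sym (suc u) zero))
  total : ∑[ u < suc n ] count (a u) ≡ 2 * R + S
  total = begin
    indicator (a zero zero) + R + ∑[ u < n ] count (a (suc u))
      ≡⟨ cong (λ b → indicator b + R + ∑[ u < n ] count (a (suc u))) (a-irrefl zero) ⟩
    R + ∑[ u < n ] count (a (suc u))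
      ≡⟨ cong (R +_) (∑-distrib-+ (λ u → indicator (a (suc u) zero)) (λ u → count (a (suc u) ∘ suc))) ⟩
    R + (∑[ u < n ] indicator (a (suc u) zero) + S)
      ≡⟨ cong (λ c → R + (c + S)) column ⟩
    R + (R + S)
      ≡⟨ sym (+-assoc R R S) ⟩
    R + R + S
      ≡⟨ cong (λ r → R + r + S) (sym (+-identityʳ R)) ⟩
    2 * R + S ∎
    where open ≡-Reasoning

regular⇒2∣n*d : ∀ {n} (G : Graph n) d → (∀ v → degree G v ≡ d) → 2 ∣ n * d
regular⇒2∣n*d {n} G d regular = subst (2 ∣_) sum-degrees (handshake (adj G) (Graph.sym G) (Graph.irrefl G))
  where
  sum-degrees : ∑[ v < n ] degree G v ≡ n * d
  sum-degrees = trans (sum-cong-≗ regular) (∑-const n d)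

degree-punchIn : ∀ {m} (G : Graph (suc m)) z → degree G z ≡ count (adj G z ∘ punchIn z)
degree-punchIn G z = trans (sum-remove {i = z} (indicator ∘ adj G z))
  (cong (λ b → indicator b + count (adj G z ∘ punchIn z)) (Graph.irrefl G z))

degree+degree-complement : ∀ {m} (G : Graph (suc m)) z → degree G z + degree (complement G) z ≡ m
degree+degree-complement {m} G z = begin
  degree G z + degree (complement G) z
    ≡⟨ cong₂ _+_ (degree-punchIn G z) (degree-punchIn (complement G) z) ⟩
  count (adj G z ∘ punchIn z) + count (adj (complement G) z ∘ punchIn z)
    ≡⟨ sym (∑-distrib-+ (λ i → indicator (adj G z (punchIn z i))) _) ⟩
  ∑[ i < m ] (indicator (adj G z (punchIn z i)) + indicator (adj (complement G) z (punchIn z i)))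
    ≡⟨ sum-cong-≗ (λ i → trans (cong (λ b → indicator (adj G z (punchIn z i)) + indicator b)
                                 (adj-complement G (punchInᵢ≢i z i ∘ sym)))
                               (exactly-one (adj G z (punchIn z i)))) ⟩
  ∑[ i < m ] 1
    ≡⟨ trans (∑-const m 1) (*-identityʳ m) ⟩
  m ∎
  where
  open ≡-Reasoning
  exactly-one : ∀ b → indicator b + indicator (not b) ≡ 1
  exactly-one true  = refl
  exactly-one false = refl

2∤1+2*d : ∀ d → ¬ 2 ∣ suc (2 * d)
2∤1+2*d d 2∣odd with () ← ∣1⇒≡1 (∣m+n∣m⇒∣n (subst (2 ∣_) (+-comm 1 (2 * d)) 2∣odd) (m∣m*n d))

-- Failing both, G would be d-regular on 2d + 1 vertices.
lowDegreeVertex : ∀ {m} (G : Graph (suc m)) d → m ≤ 2 * d → ¬ 2 ∣ d →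
                  ∃ λ z → degree G z < d ⊎ degree (complement G) z < d
lowDegreeVertex {m} G d m≤2d 2∤d with any? (λ z → degree G z <? d) | any? (λ z → degree (complement G) z <? d)
... | yes (z , low) | _              = z , inj₁ low
... | no _          | yes (z , low)  = z , inj₂ low
... | no ¬low       | no ¬low-compl  = ⊥-elim ([ 2∤1+2*d d , 2∤d ]′ (euclidsLemma (suc (2 * d)) d prime[2] 2∣n*d))
  where
  d≤degree : ∀ v → d ≤ degree G v
  d≤degree v = ≮⇒≥ (¬low ∘ (v ,_))
  d≤degree-compl : ∀ v → d ≤ degree (complement G) v
  d≤degree-compl v = ≮⇒≥ (¬low-compl ∘ (v ,_))
  2*d≡d+d : 2 * d ≡ d + d
  2*d≡d+d = cong (d +_) (+-identityʳ d)
  d+d≤m : ∀ v → d + d ≤ m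
  d+d≤m v = subst (d + d ≤_) (degree+degree-complement G v) (+-mono-≤ (d≤degree v) (d≤degree-compl v))
  regular : ∀ v → degree G v ≡ d
  regular v = ≤-antisym (+-cancelʳ-≤ d (degree G v) d (begin
    degree G v + d                        ≤⟨ +-monoʳ-≤ (degree G v) (d≤degree-compl v) ⟩
    degree G v + degree (complement G) v  ≡⟨ degree+degree-complement G v ⟩
    m                                     ≤⟨ m≤2d ⟩
    2 * d                                 ≡⟨ 2*d≡d+d ⟩
    d + d                                 ∎)) (d≤degree v)
    where open ≤-Reasoning
  2∣n*d : 2 ∣ suc (2 * d) * d
  2∣n*d = subst (λ n → 2 ∣ n * d) (cong suc (≤-antisym m≤2d (subst (_≤ m) (sym 2*d≡d+d) (d+d≤m zero))))
                (regular⇒2∣n*d G d regular)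

injective⇒surjective : ∀ {n} {f : Fin n → Fin n} → Injective _≡_ _≡_ f → ∀ y → ∃ λ x → f x ≡ y
injective⇒surjective {suc m} {f} f-inj y with any? (λ x → f x ≟ y)
... | yes hit  = hit
... | no  miss = contradiction (injective⇒≤ f-minus-y-inj) (n≮n m)
  where
  f-minus-y : Fin (suc m) → Fin m
  f-minus-y x = punchOut {i = y} {j = f x} (λ e → miss (x , sym e))
  f-minus-y-inj : Injective _≡_ _≡_ f-minus-y
  f-minus-y-inj {x} {x′} = f-inj ∘ punchOut-injective (λ e → miss (x , sym e)) (λ e → miss (x′ , sym e))

lowNumbering : ∀ {n} (P : Fin n → Bool) →
  ∃ λ (τ : Fin n → Fin n) → Injective _≡_ _≡_ τ × (∀ u → P u ≡ true → toℕ (τ u) < count P)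
lowNumbering {zero} P = (λ ()) , (λ {}) , λ ()
lowNumbering {suc m} P with lowNumbering (P ∘ suc) | P zero in P0
... | τ , τ-inj , τ-low | true = τ⁺ , τ⁺-inj , τ⁺-low
  where
  τ⁺ : Fin (suc m) → Fin (suc m)
  τ⁺ zero    = zero
  τ⁺ (suc u) = suc (τ u)
  τ⁺-inj : Injective _≡_ _≡_ τ⁺
  τ⁺-inj {zero}  {zero}  _ = refl
  τ⁺-inj {suc u} {suc v} e = cong suc (τ-inj (suc-injective e))
  τ⁺-low : ∀ u → P u ≡ true → toℕ (τ⁺ u) < suc (count (P ∘ suc))
  τ⁺-low zero    _  = s≤s z≤n
  τ⁺-low (suc u) Pu = s≤s (τ-low u Pu)
... | τ , τ-inj , τ-low | false = τ⁺ , τ⁺-inj , τ⁺-low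
  where
  τ⁺ : Fin (suc m) → Fin (suc m)
  τ⁺ zero    = fromℕ m
  τ⁺ (suc u) = inject₁ (τ u)
  τ⁺-inj : Injective _≡_ _≡_ τ⁺
  τ⁺-inj {zero}  {zero}  _ = refl
  τ⁺-inj {zero}  {suc v} e = contradiction e (fromℕ≢inject₁)
  τ⁺-inj {suc u} {zero}  e = contradiction (sym e) (fromℕ≢inject₁)
  τ⁺-inj {suc u} {suc v} e = cong suc (τ-inj (inject₁-injective e))
  τ⁺-low : ∀ u → P u ≡ true → toℕ (τ⁺ u) < count (P ∘ suc)
  τ⁺-low zero    Pu = contradiction (trans (sym Pu) P0) λ ()
  τ⁺-low (suc u) Pu = subst (_< count (P ∘ suc)) (sym (toℕ-inject₁ (τ u))) (τ-low u Pu)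

hubFirstNumbering : ∀ {m} (G : Graph (suc m)) z →
  ∃ λ (ν : Fin (suc m) → Fin (suc m)) → Injective _≡_ _≡_ ν × ν z ≡ zero ×
    (∀ u → adj G z u ≡ true → toℕ (ν u) ≤ degree G z)
hubFirstNumbering {m} G z with τ , τ-inj , τ-low ← lowNumbering (adj G z ∘ punchIn z) =
  ν , ν-inj , ν-hub , ν-low
  where
  ν : Fin (suc m) → Fin (suc m)
  ν u with z ≟ u
  ... | yes _   = zero
  ... | no  z≢u = suc (τ (punchOut z≢u))
  ν-inj : Injective _≡_ _≡_ ν
  ν-inj {u} {v} e with z ≟ u | z ≟ v
  ... | yes z≡u | yes z≡v = trans (sym z≡u) z≡v
  ... | no  z≢u | no  z≢v = punchOut-injective z≢u z≢v (τ-inj (suc-injective e))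
  ν-hub : ν z ≡ zero
  ν-hub with z ≟ z
  ... | yes _   = refl
  ... | no  z≢z = contradiction refl z≢z
  ν-low : ∀ u → adj G z u ≡ true → toℕ (ν u) ≤ degree G z
  ν-low u zu with z ≟ u
  ... | yes refl = contradiction (trans (sym zu) (Graph.irrefl G z)) λ ()
  ... | no  z≢u  = subst (suc (toℕ (τ (punchOut z≢u))) ≤_) (sym (degree-punchIn G z))
                     (τ-low (punchOut z≢u) (trans (cong (adj G z) (punchIn-punchOut z≢u)) zu))

-- The hub gets number 0, hence the full code; a singleton code {s} means that all j + 1 low bits
-- except bit s are 1, so the number is at least 2^j − 1.
binaryCode : ∀ {n} j → (Fin n → Fin n) → Fin n → Fin (suc j) → Bool
binaryCode j ν p i = not (testBit (toℕ (ν p)) (toℕ i))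

module _ {m} (K : Graph (suc m)) (j : ℕ) (1≤j : 1 ≤ j) (2^j≤n : 2 ^ j ≤ suc m) (n<2^1+j : suc m < 2 ^ suc j)
  (ν : Fin (suc m) → Fin (suc m)) (ν-inj : Injective _≡_ _≡_ ν) (z : Fin (suc m)) (ν-hub : ν z ≡ zero)
  (neighbours-low : ∀ u → adj K z u ≡ true → toℕ (ν u) < 2 ^ j ∸ 1)
  where

  private
    code = binaryCode j ν
    k = suc j

    bits-set : ∀ {p} {l} → (∀ (i : Fin k) → toℕ i < l → testBit (toℕ (ν p)) (toℕ i) ≡ true) →
               l ≤ k → 2 ^ l ≤ suc (toℕ (ν p))
    bits-set {p} {l} set l≤k = lowBits-set⇒2^≤suc l (toℕ (ν p)) λ i i<l →
      let i<k = <-≤-trans i<l l≤k in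
      subst (λ i′ → testBit (toℕ (ν p)) i′ ≡ true) (toℕ-fromℕ< i<k)
            (set (fromℕ< i<k) (subst (_< l) (sym (toℕ-fromℕ< i<k)) i<l))

    nonneighbour : ∀ p → 2 ^ j ∸ 1 ≤ toℕ (ν p) → adj K p z ≡ false
    nonneighbour p high with adj K z p in zp
    ... | true  = contradiction high (<⇒≱ (neighbours-low p zp))
    ... | false = trans (Graph.sym K p z) zp

    injective : ∀ p q → (∀ i → code p i ≡ code q i) → p ≡ q
    injective p q same = ν-inj (toℕ-injective (testBit-injective k (below p) (below q) λ i i<k →
      subst (λ i′ → testBit (toℕ (ν p)) i′ ≡ testBit (toℕ (ν q)) i′) (toℕ-fromℕ< i<k)
            (not-injective (same (fromℕ< i<k)))))
      where
      below : ∀ p → toℕ (ν p) < 2 ^ k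
      below p = <-trans (toℕ<n (ν p)) n<2^1+j

    nonempty : ∀ p → ∃ λ i → code p i ≡ true
    nonempty p with all? (λ i → testBit (toℕ (ν p)) (toℕ i) ≟ᵇ true)
    ... | yes all-set = contradiction (≤-<-trans (bits-set (λ i _ → all-set i) ≤-refl)
                                                 (<-≤-trans (s≤s (toℕ<n (ν p))) n<2^1+j)) (<-irrefl refl)
    ... | no  ¬all    = let i , unset = ¬∀⟶∃¬ k _ (λ i → testBit (toℕ (ν p)) (toℕ i) ≟ᵇ true) ¬all in
                        i , cong not (¬-not unset)

    vertexNumbered : ∀ t → t < suc m → ∃ λ w → toℕ (ν w) ≡ t
    vertexNumbered t t<n = let w , νw = injective⇒surjective ν-inj (fromℕ< t<n) in
                           w , trans (cong toℕ νw) (toℕ-fromℕ< t<n)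

    missesOnly-below : ∀ c → toℕ c < j → ∃ λ w → MissesOnly K code w c
    missesOnly-below c c<j
      with w , νw ← vertexNumbered (2 ^ toℕ c) (<-≤-trans (^-monoʳ-< 2 (s≤s (s≤s z≤n)) c<j) 2^j≤n) =
      w , trans (codeAt c) (cong not (dec-true (toℕ c ≟ℕ toℕ c) refl))
        , λ i i≢c → trans (codeAt i)
                          (cong not (dec-false (toℕ c ≟ℕ toℕ i) (i≢c ∘ sym ∘ toℕ-injective)))
      where
      codeAt : ∀ i → code w i ≡ not (does (toℕ c ≟ℕ toℕ i))
      codeAt i = cong not (trans (cong (λ x → testBit x (toℕ i)) νw) (testBit-2^ (toℕ c) (toℕ i)))

    missesOnly : ∀ a b → a ≢ b → (∃ λ w → MissesOnly K code w a) ⊎ (∃ λ w → MissesOnly K code w b)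
    missesOnly a b a≢b with toℕ a <? j
    ... | yes a<j = inj₁ (missesOnly-below a a<j)
    ... | no  a≮j = inj₂ (missesOnly-below b
                        (≤∧≢⇒< (s≤s⁻¹ (toℕ<n b)) λ b≡j → a≢b (toℕ-injective (trans a≡j (sym b≡j)))))
      where
      a≡j : toℕ a ≡ j
      a≡j = ≤-antisym (s≤s⁻¹ (toℕ<n a)) (≮⇒≥ a≮j)

    singleton-¬hub : ∀ p s → (∀ i → code p i ≡ true → i ≡ s) → adj K p z ≡ false
    singleton-¬hub p s only = nonneighbour p high
      where
      set : ∀ i → i ≢ s → testBit (toℕ (ν p)) (toℕ i) ≡ true
      set i i≢s = not-injective (¬-not (i≢s ∘ only i))
      high : 2 ^ j ∸ 1 ≤ toℕ (ν p)
      high with toℕ s ≟ℕ j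
      ... | yes s≡j = ∸-monoˡ-≤ 1 (bits-set (λ i i<j → set i λ { refl → <-irrefl s≡j i<j }) (n≤1+n j))
      ... | no  s≢j = ≤-trans (m∸n≤m (2 ^ j) 1) (testBit⇒2^≤ j (toℕ (ν p))
                        (subst (λ i → testBit (toℕ (ν p)) i ≡ true) (toℕ-fromℕ j)
                               (set (fromℕ j) λ j≡s → s≢j (trans (cong toℕ (sym j≡s)) (toℕ-fromℕ j)))))

    hub-nonneighbour : ∃ λ q → q ≢ z × adj K q z ≡ false
    hub-nonneighbour
      with q , νq ← vertexNumbered (2 ^ j ∸ 1) (<-≤-trans (∸-monoʳ-< {2 ^ j} (s≤s z≤n) (m^n>0 2 j)) 2^j≤n) =
      q , (λ { refl → contradiction (trans (sym νq) (cong toℕ ν-hub)) (>⇒≢ 1≤T) })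
        , nonneighbour q (≤-reflexive (sym νq))
      where
      1≤T : 1 ≤ 2 ^ j ∸ 1
      1≤T = ∸-monoˡ-≤ 1 (^-monoʳ-≤ 2 1≤j)

  binaryCode-isSimpleCode : IsSimpleCode K code
  binaryCode-isSimpleCode = record
    { hub              = z
    ; hub-full         = λ i → trans (cong (λ x → not (testBit (toℕ x) (toℕ i))) ν-hub)
                                     (cong not (testBit-0 (toℕ i)))
    ; injective        = injective
    ; nonempty         = nonempty
    ; missesOnly       = missesOnly
    ; singleton-¬hub   = singleton-¬hub
    ; hub-nonneighbour = hub-nonneighbour
    }

2^j<x⇒j<⌈log₂x⌉ : ∀ j {x} → 2 ^ j < x → j < ⌈log₂ x ⌉
2^j<x⇒j<⌈log₂x⌉ zero    2≤x = ≤-trans (≤-reflexive (sym (⌈log₂2^n⌉≡n 1))) (⌈log₂⌉-mono-≤ 2≤x)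
2^j<x⇒j<⌈log₂x⌉ (suc j) {x} 2^1+j<x =
  j<L∸1⇒1+j<L ⌈log₂ x ⌉ (subst (j <_) (⌈log₂⌈n/2⌉⌉≡⌈log₂n⌉∸1 x) (2^j<x⇒j<⌈log₂x⌉ j 2^j<⌈x/2⌉))
  where
  2^j<⌈x/2⌉ : 2 ^ j < ⌈ x /2⌉
  2^j<⌈x/2⌉ = subst (_≤ ⌈ x /2⌉) (cong suc (⌊2*h/2⌋≡h (2 ^ j))) (⌈n/2⌉-mono 2^1+j<x)
  j<L∸1⇒1+j<L : ∀ L → j < L ∸ 1 → suc j < L
  j<L∸1⇒1+j<L (suc L) j<L = s≤s j<L

binaryMagnitude : ∀ n → 1 ≤ n → ∃ λ j → 2 ^ j ≤ n × n < 2 ^ suc j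
binaryMagnitude (suc zero)    _ = 0 , s≤s z≤n , s≤s (s≤s z≤n)
binaryMagnitude (suc (suc n)) _ with j , 2^j≤n , n<2^1+j ← binaryMagnitude (suc n) (s≤s z≤n)
                              with suc (suc n) <? 2 ^ suc j
... | yes n<2^1+j′ = j , m≤n⇒m≤1+n 2^j≤n , n<2^1+j′
... | no  n≮2^1+j  = suc j , ≤-reflexive (sym n≡2^1+j)
                   , subst (_< 2 ^ suc (suc j)) (sym n≡2^1+j) (^-monoʳ-< 2 (s≤s (s≤s z≤n)) (n<1+n (suc j)))
  where
  n≡2^1+j : suc (suc n) ≡ 2 ^ suc j
  n≡2^1+j = ≤-antisym n<2^1+j (≮⇒≥ n≮2^1+j)

2^j∸1-odd : ∀ j → 1 ≤ j → ¬ 2 ∣ 2 ^ j ∸ 1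
2^j∸1-odd (suc j) _ 2∣T = contradiction (∣1⇒≡1 (∣m+n∣m⇒∣n 2∣T+1 2∣T)) λ ()
  where
  2∣T+1 : 2 ∣ 2 ^ suc j ∸ 1 + 1
  2∣T+1 = subst (2 ∣_) (sym (m∸n+n≡m (m^n>0 2 (suc j)))) (m∣m*n (2 ^ j))

module _ {m} (j : ℕ) (1≤j : 1 ≤ j) (2^j≤n : 2 ^ j ≤ suc m) (n<2^1+j : suc m < 2 ^ suc j) where

  private
    m≤2T : m ≤ 2 * (2 ^ j ∸ 1)
    m≤2T = subst (m ≤_) (sym (*-distribˡ-∸ 2 (2 ^ j) 1)) (∸-monoˡ-≤ 2 n<2^1+j)

  lowHubExtension : (K : Graph (suc m)) (z : Fin (suc m)) → degree K z < 2 ^ j ∸ 1 →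
    Σ (Graph (suc m + suc j)) λ G′ → InducedSubgraph K G′ × IsSimple G′
  lowHubExtension K z low with ν , ν-inj , ν-hub , ν-low ← hubFirstNumbering K z =
    extendByCode K code , extendByCode-induced K code , extendByCode-isSimple K code
      (binaryCode-isSimpleCode K j 1≤j 2^j≤n n<2^1+j ν ν-inj z ν-hub λ u zu → ≤-<-trans (ν-low u zu) low)
    where
    code = binaryCode j ν

  simpleExtension : (K : Graph (suc m)) → Σ (Graph (suc m + suc j)) λ G′ → InducedSubgraph K G′ × IsSimple G′
  simpleExtension K with lowDegreeVertex K (2 ^ j ∸ 1) m≤2T (2^j∸1-odd j 1≤j)
  ... | z , inj₁ low = lowHubExtension K z low
  ... | z , inj₂ low with G′ , K⊑G′ , simple ← lowHubExtension (complement K) z low =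
        complement G′ , induced-in-complement K G′ K⊑G′ , complement-isSimple G′ simple

oneVertex-isSimple : (G : Graph 1) → IsSimple G
oneVertex-isSimple G I _ = isTrivial-if-pair-full I λ { zero zero 0≢0 → contradiction refl 0≢0 }

theorem3p1 : ∀ (n : ℕ) → 1 ≤ n → (G : Graph n) →
    Σ ℕ λ m → Σ (Graph m) λ G' →
      InducedSubgraph G G' × IsSimple G' × (m ∸ n ≤ ⌈log₂ (suc n) ⌉)
theorem3p1 (suc zero) _ G = 1 , G , ((λ u → u) , (λ e → e) , λ _ _ → refl) , oneVertex-isSimple G , z≤n
theorem3p1 n@(suc (suc _)) 1≤n G with binaryMagnitude n 1≤n
... | zero  , _     , s≤s (s≤s ())
... | suc j , 2^j≤n , n<2^1+j with G′ , G⊑G′ , simple ← simpleExtension (suc j) (s≤s z≤n) 2^j≤n n<2^1+j G =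
  n + suc (suc j) , G′ , G⊑G′ , simple ,
  subst (_≤ ⌈log₂ suc n ⌉) (sym (m+n∸m≡n n (suc (suc j)))) (2^j<x⇒j<⌈log₂x⌉ (suc j) (s≤s 2^j≤n))
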